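{- Let $P=A\cup B$ be a bipartite poset and let $Q=\{u_1,\dots,u_m\}\cup\{v_1,\dots,v_m\}$ be a maximal matching in $P$ (with $m$ elements in $A$ and $m$ in $B$). Then $\operatorname{Idim}^*(P)\le m$.
   Context: A bipartite poset is a finite poset $P$ with a partition $P=A\cup B$ where $A\subseteq\operatorname{Min}(P)$ and $B\subseteq\operatorname{Max}(P)$. A matching is a set of elements labelled $u_1,\dots,u_m\in A$, $v_1,\dots,v_m\in B$ (all distinct) with $u_i\parallel v_i$ in $P$ for each $i$; it is maximal if there is no pair $a\in A\setminus Q$, $b\in B\setminus Q$ with $a\parallel b$ in $P$. With $L_1,\dots,L_N$ all linear extensions of $P$, $\operatorname{Idim}^*(P)$ is the least real $d\ge0$ such that there are non-negative reals $\alpha_1,\dots,\alpha_N$ with $\sum_i\alpha_i=d$ and, for every $(a,b)\in A\times B$ with $a\parallel b$ in $P$, $\sum\{\alpha_i: a>b\text{ in }L_i\}\ge1$. -}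

module Defs where

open import Level using (0ℓ)
open import Data.Nat using (ℕ)
open import Data.Fin using (Fin; _<_; _<?_)
open import Data.Fin.Subset using (Subset; _∈_; _∉_)
open import Data.Fin.Permutation using (Permutation′; _⟨$⟩ʳ_)
open import Data.Rational using (ℚ; 0ℚ; _+_; _≤_)
open import Data.List using (List; []; _∷_; map; foldr)
open import Data.List.Relation.Unary.All using (All)
open import Data.Product using (_×_; _,_; proj₁; proj₂; Σ; ∃)
open import Data.Sum using (_⊎_)
open import Data.Empty using (⊥)
open import Relation.Binary using (Rel; IsDecPartialOrder)
open import Relation.Binary.PropositionalEquality using (_≡_; _≢_)
open import Relation.Nullary using (¬_; yes; no)
open import Function.Definitions using (Injective)

record FinPoset (n : ℕ) : Set₁ where
  field
    _≼_      : Rel (Fin n) 0ℓ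
    isDecPO  : IsDecPartialOrder _≡_ _≼_

module _ {n : ℕ} (P : FinPoset n) where
  open FinPoset P

  Incomparable : Fin n → Fin n → Set
  Incomparable x y = ¬ (x ≼ y) × ¬ (y ≼ x)

  IsMinimal : Fin n → Set
  IsMinimal x = ∀ y → y ≼ x → y ≡ x

  IsMaximal : Fin n → Set
  IsMaximal x = ∀ y → x ≼ y → y ≡ x

  -- A linear extension, given by the position map of its elements:
  -- pos x is the position of x in L (so x < y in L iff pos x < pos y).
  record LinearExtension : Set where
    field
      pos      : Permutation′ n
      monotone : ∀ x y → x ≼ y → (pos ⟨$⟩ʳ x) Data.Fin.≤ (pos ⟨$⟩ʳ y)

  AboveIn : LinearExtension → Fin n → Fin n → Set
  AboveIn L a b = (LinearExtension.pos L ⟨$⟩ʳ b) < (LinearExtension.pos L ⟨$⟩ʳ a)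

record BipartitePoset (n : ℕ) : Set₁ where
  field
    poset    : FinPoset n
    A B      : Subset n
    cover    : ∀ x → x ∈ A ⊎ x ∈ B
    disjoint : ∀ x → x ∈ A → x ∈ B → ⊥
    A⊆Min    : ∀ x → x ∈ A → IsMinimal poset x
    B⊆Max    : ∀ x → x ∈ B → IsMaximal poset x
  open FinPoset poset public

record Matching {n : ℕ} (P : BipartitePoset n) (m : ℕ) : Set where
  open BipartitePoset P
  field
    u v     : Fin m → Fin n
    u-inj   : Injective _≡_ _≡_ u
    v-inj   : Injective _≡_ _≡_ v
    u∈A     : ∀ i → u i ∈ A
    v∈B     : ∀ i → v i ∈ B
    u∥v     : ∀ i → Incomparable poset (u i) (v i)

IsMaximalMatching : ∀ {n m} {P : BipartitePoset n} → Matching P m → Set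
IsMaximalMatching {n} {m} {P} M =
  ∀ a b → a ∈ A → b ∈ B → (∀ i → u i ≢ a) → (∀ i → v i ≢ b) →
  ¬ Incomparable poset a b
  where open BipartitePoset P
        open Matching M

module _ {n : ℕ} (P : BipartitePoset n) where
  open BipartitePoset P

  totalWeight : List (LinearExtension poset × ℚ) → ℚ
  totalWeight = foldr (λ p s → proj₂ p + s) 0ℚ

  weightAbove : Fin n → Fin n → List (LinearExtension poset × ℚ) → ℚ
  weightAbove a b [] = 0ℚ
  weightAbove a b ((L , α) ∷ rest) with
    (LinearExtension.pos L ⟨$⟩ʳ b) <? (LinearExtension.pos L ⟨$⟩ʳ a)
  ... | yes _ = α + weightAbove a b rest
  ... | no  _ = weightAbove a b rest

  IsFractionalRealizer : List (LinearExtension poset × ℚ) → Set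
  IsFractionalRealizer ws =
    All (λ p → 0ℚ ≤ proj₂ p) ws ×
    (∀ a b → a ∈ A → b ∈ B → Incomparable poset a b →
       Data.Rational.1ℚ ≤ weightAbove a b ws)

  -- Idim*(P) ≤ d  (the LP minimum is attained, so this is existence of a
  -- feasible weighting of total weight ≤ d)
  IdimStar≤ : ℚ → Set
  IdimStar≤ d = Σ (List (LinearExtension poset × ℚ)) λ ws →
    IsFractionalRealizer ws × totalWeight ws ≤ d

-- For each matched pair (uᵢ, vᵢ) take a linear extension Lᵢ in which uᵢ lies above every element
-- of B not above it and vᵢ lies below every element of A not below it. By maximality of the
-- matching every incomparable pair (a, b) ∈ A × B meets the matching, in a = uᵢ or b = vᵢ, and is
-- then reversed in Lᵢ; so weight 1 on each of L₁, …, Lₘ is a fractional realizer of weight m.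
module Submission where

open import Data.Bool.Properties using (T-≡)
open import Data.Fin as Fin using (Fin; toℕ; fromℕ<; punchOut)
open import Data.Fin.Permutation using (Permutation′; permutation; _⟨$⟩ʳ_)
open import Data.Fin.Properties as Finₚ
  using (any?; pigeonhole; punchOut-injective; toℕ-injective; toℕ-fromℕ<; toℕ<n)
open import Data.Fin.Subset using (Subset; _∈_; _∉_; _⊂_; ⊤; ∣_∣)
open import Data.Fin.Subset.Properties using (_∈?_; ∈⊤; ∣⊤∣≡n; p⊂q⇒∣p∣<∣q∣)
open import Data.Integer as ℤ using (+_)
import Data.Integer.Properties as ℤₚ
open import Data.List using (List; []; _∷_; map; length; tabulate)
open import Data.List.Properties using (length-tabulate)
open import Data.List.Membership.Propositional using () renaming (_∈_ to _∈ˡ_)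
open import Data.List.Membership.Propositional.Properties using (∈-map⁺; ∈-tabulate⁺)
open import Data.List.Relation.Unary.All as All using (All; []; _∷_)
open import Data.List.Relation.Unary.All.Properties as Allₚ using ()
open import Data.List.Relation.Unary.Any using (here; there)
open import Data.Nat as ℕ using (ℕ; suc; _<ᵇ_)
open import Data.Nat.Coprimality using (1-coprimeTo) renaming (sym to coprime-sym)
open import Data.Nat.Properties as ℕₚ using (<-cmp; <-irrefl; <ᵇ⇒<; <⇒<ᵇ)
open import Data.Product using (_×_; _,_; proj₁; proj₂; ∃)
open import Data.Rational as ℚ using (ℚ; 0ℚ; 1ℚ; mkℚ; _/_)
import Data.Rational.Properties as ℚₚ
open import Data.Sum using (inj₁; inj₂)
import Data.Vec as Vec
open import Data.Vec.Properties using (lookup∘tabulate; lookup⇒[]=; []=⇒lookup)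
open import Function using (Equivalence)
open import Function.Definitions using (Injective)
open import Relation.Binary using (IsDecPartialOrder; tri<; tri≈; tri>)
open import Relation.Binary.PropositionalEquality hiding (poset)
open import Relation.Nullary using (¬_; yes; no; contradiction)
open import Relation.Nullary.Decidable using (from-yes)

open import Defs

private
  variable
    n : ℕ

-- A missed y would let punchOut y turn f into an injection of Fin (suc n) into Fin n.
injective⇒∃-preimage : {f : Fin n → Fin n} → Injective _≡_ _≡_ f → ∀ y → ∃ λ x → f x ≡ y
injective⇒∃-preimage {suc n} {f} f-inj y with any? (λ x → f x Finₚ.≟ y)
... | yes preimage = preimage
... | no ∄x with pigeonhole (ℕₚ.n<1+n n) (λ x → punchOut (λ fx≡y → ∄x (x , sym fx≡y)))
...   | i , j , i<j , same = contradiction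
          (f-inj (punchOut-injective (λ e → ∄x (i , sym e)) (λ e → ∄x (j , sym e)) same))
          (Finₚ.<⇒≢ i<j)

permutationOfInjection : (f : Fin n → Fin n) → Injective _≡_ _≡_ f → Permutation′ n
permutationOfInjection f f-inj = permutation f (λ y → proj₁ (preimage y))
  (λ y → proj₂ (preimage y)) (λ x → f-inj (proj₂ (preimage (f x))))
  where preimage = injective⇒∃-preimage f-inj

module _ (key : Fin n → ℕ) where

  keysBelow : Fin n → Subset n
  keysBelow x = Vec.tabulate (λ z → key z <ᵇ key x)

  keysBelow⁺ : ∀ {x z} → key z ℕ.< key x → z ∈ keysBelow x
  keysBelow⁺ {x} {z} k = lookup⇒[]= z (keysBelow x)
    (trans (lookup∘tabulate _ z) (Equivalence.to T-≡ (<⇒<ᵇ k)))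

  keysBelow⁻ : ∀ {x z} → z ∈ keysBelow x → key z ℕ.< key x
  keysBelow⁻ {x} {z} z∈ = <ᵇ⇒< (key z) (key x)
    (Equivalence.from T-≡ (trans (sym (lookup∘tabulate _ z)) ([]=⇒lookup z∈)))

  ∉keysBelow-self : ∀ x → x ∉ keysBelow x
  ∉keysBelow-self x x∈ = <-irrefl refl (keysBelow⁻ x∈)

  keysBelow-⊂ : ∀ {x y} → key x ℕ.< key y → keysBelow x ⊂ keysBelow y
  keysBelow-⊂ {x} k =
    (λ z∈ → keysBelow⁺ (ℕₚ.<-trans (keysBelow⁻ z∈) k)) , x , keysBelow⁺ k , ∉keysBelow-self x

  ∣keysBelow∣<n : ∀ x → ∣ keysBelow x ∣ ℕ.< n
  ∣keysBelow∣<n x = subst (∣ keysBelow x ∣ ℕ.<_) (∣⊤∣≡n n)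
    (p⊂q⇒∣p∣<∣q∣ ((λ _ → ∈⊤) , x , ∈⊤ , ∉keysBelow-self x))

  rankByKey : Fin n → Fin n
  rankByKey x = fromℕ< (∣keysBelow∣<n x)

  rankByKey-mono : ∀ {x y} → key x ℕ.< key y → rankByKey x Fin.< rankByKey y
  rankByKey-mono {x} {y} k rewrite toℕ-fromℕ< (∣keysBelow∣<n x) | toℕ-fromℕ< (∣keysBelow∣<n y) =
    p⊂q⇒∣p∣<∣q∣ (keysBelow-⊂ k)

  rankByKey-injective : Injective _≡_ _≡_ key → Injective _≡_ _≡_ rankByKey
  rankByKey-injective key-inj {x} {y} eq with <-cmp (key x) (key y)
  ... | tri< k _ _ = contradiction (cong toℕ eq) (ℕₚ.<⇒≢ (rankByKey-mono k))
  ... | tri≈ _ k _ = key-inj k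
  ... | tri> _ _ k = contradiction (cong toℕ eq) (ℕₚ.>⇒≢ (rankByKey-mono k))

  sortByKey : Injective _≡_ _≡_ key → Permutation′ n
  sortByKey key-inj = permutationOfInjection rankByKey (rankByKey-injective key-inj)

module _ (R : Fin n → ℕ) where

  tieBrokenKey : Fin n → ℕ
  tieBrokenKey x = R x ℕ.* n ℕ.+ toℕ x

  tieBrokenKey-mono : ∀ {x y} → R x ℕ.< R y → tieBrokenKey x ℕ.< tieBrokenKey y
  tieBrokenKey-mono {x} {y} r = begin-strict
    R x ℕ.* n ℕ.+ toℕ x   <⟨ ℕₚ.+-monoʳ-< (R x ℕ.* n) (toℕ<n x) ⟩
    R x ℕ.* n ℕ.+ n       ≡⟨ ℕₚ.+-comm (R x ℕ.* n) n ⟩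
    suc (R x) ℕ.* n       ≤⟨ ℕₚ.*-monoˡ-≤ n r ⟩
    R y ℕ.* n             ≤⟨ ℕₚ.m≤m+n (R y ℕ.* n) (toℕ y) ⟩
    tieBrokenKey y        ∎
    where open ℕₚ.≤-Reasoning

  tieBrokenKey-injective : Injective _≡_ _≡_ tieBrokenKey
  tieBrokenKey-injective {x} {y} eq with <-cmp (R x) (R y)
  ... | tri< r _ _ = contradiction eq (ℕₚ.<⇒≢ (tieBrokenKey-mono r))
  ... | tri≈ _ r _ = toℕ-injective (ℕₚ.+-cancelˡ-≡ (R x ℕ.* n) (toℕ x) (toℕ y)
                       (trans eq (cong (λ r → r ℕ.* n ℕ.+ toℕ y) (sym r))))
  ... | tri> _ _ r = contradiction eq (ℕₚ.>⇒≢ (tieBrokenKey-mono r))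

  sortByRank : Permutation′ n
  sortByRank = sortByKey tieBrokenKey tieBrokenKey-injective

  sortByRank-mono : ∀ {x y} → R x ℕ.< R y → sortByRank ⟨$⟩ʳ x Fin.< sortByRank ⟨$⟩ʳ y
  sortByRank-mono r = rankByKey-mono tieBrokenKey (tieBrokenKey-mono r)

module _ (P : FinPoset n) (R : Fin n → ℕ) where
  open FinPoset P

  StrictlyMonotone : Set
  StrictlyMonotone = ∀ {x y} → x ≼ y → x ≢ y → R x ℕ.< R y

  linearExtensionByRank : StrictlyMonotone → LinearExtension P
  linearExtensionByRank R-mono = record { pos = sortByRank R ; monotone = monotone }
    where
    monotone : ∀ x y → x ≼ y → sortByRank R ⟨$⟩ʳ x Fin.≤ sortByRank R ⟨$⟩ʳ y
    monotone x y x≼y with x Finₚ.≟ y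
    ... | yes refl = ℕₚ.≤-refl
    ... | no x≢y   = ℕₚ.<⇒≤ (sortByRank-mono R (R-mono x≼y x≢y))

  aboveIn-linearExtensionByRank : (R-mono : StrictlyMonotone) →
                                  ∀ {a b} → R b ℕ.< R a → AboveIn P (linearExtensionByRank R-mono) a b
  aboveIn-linearExtensionByRank _ = sortByRank-mono R

module _ (P : BipartitePoset n) where
  open BipartitePoset P
  open IsDecPartialOrder isDecPO using (_≤?_; _≟_)

  strictlyBelow⇒∈A×∈B : ∀ {x y} → x ≼ y → x ≢ y → x ∈ A × y ∈ B
  strictlyBelow⇒∈A×∈B {x} {y} x≼y x≢y with cover x | cover y
  ... | inj₂ x∈B | _        = contradiction (sym (B⊆Max x x∈B y x≼y)) x≢y
  ... | _        | inj₁ y∈A = contradiction (A⊆Min y y∈A x x≼y) x≢y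
  ... | inj₁ x∈A | inj₂ y∈B = x∈A , y∈B

  -- Levels of the extension, bottom to top: A ∩ ↓v, v, the rest of A, the rest of B, u, B ∩ ↑u.
  module PairExtension (u v : Fin n) (u⋠v : ¬ u ≼ v) where

    rankA : Fin n → ℕ
    rankA x with x ≤? v | x ≟ u
    ... | yes _ | _     = 0
    ... | no _  | yes _ = 4
    ... | no _  | no _  = 2

    rankB : Fin n → ℕ
    rankB y with y ≟ v | u ≤? y
    ... | yes _ | _     = 1
    ... | no _  | yes _ = 5
    ... | no _  | no _  = 3

    rank : Fin n → ℕ
    rank x with x ∈? A
    ... | yes _ = rankA x
    ... | no _  = rankB x

    rank-∈A : ∀ {x} → x ∈ A → rank x ≡ rankA x
    rank-∈A {x} x∈A with x ∈? A
    ... | yes _   = refl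
    ... | no x∉A  = contradiction x∈A x∉A

    rank-∈B : ∀ {x} → x ∈ B → rank x ≡ rankB x
    rank-∈B {x} x∈B with x ∈? A
    ... | yes x∈A = contradiction x∈B (disjoint x x∈A)
    ... | no _    = refl

    rankA<rankB : ∀ {x y} → x ≼ y → rankA x ℕ.< rankB y
    rankA<rankB {x} {y} x≼y with x ≤? v | x ≟ u | y ≟ v | u ≤? y
    ... | yes _   | _        | yes _ | _        = from-yes (0 ℕ.<? 1)
    ... | yes _   | _        | no _  | yes _    = from-yes (0 ℕ.<? 5)
    ... | yes _   | _        | no _  | no _     = from-yes (0 ℕ.<? 3)
    ... | no x⋠v  | _        | yes refl | _     = contradiction x≼y x⋠v
    ... | no _    | yes refl | no _  | yes _    = from-yes (4 ℕ.<? 5)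
    ... | no _    | yes refl | no _  | no u⋠y   = contradiction x≼y u⋠y
    ... | no _    | no _     | no _  | yes _    = from-yes (2 ℕ.<? 5)
    ... | no _    | no _     | no _  | no _     = from-yes (2 ℕ.<? 3)

    rank-mono : StrictlyMonotone poset rank
    rank-mono x≼y x≢y with strictlyBelow⇒∈A×∈B x≼y x≢y
    ... | x∈A , y∈B rewrite rank-∈A x∈A | rank-∈B y∈B = rankA<rankB x≼y

    pairExtension : LinearExtension poset
    pairExtension = linearExtensionByRank poset rank rank-mono

    pairExtension-raises-u : ∀ {b} → u ∈ A → b ∈ B → ¬ u ≼ b → AboveIn poset pairExtension u b
    pairExtension-raises-u {b} u∈A b∈B u⋠b =
      aboveIn-linearExtensionByRank poset rank rank-mono {u} {b}
        (subst₂ ℕ._<_ (sym (rank-∈B b∈B)) (sym (rank-∈A u∈A)) rankB<rankA)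
      where
      rankB<rankA : rankB b ℕ.< rankA u
      rankB<rankA with u ≤? v | u ≟ u | b ≟ v | u ≤? b
      ... | yes u≼v | _       | _     | _      = contradiction u≼v u⋠v
      ... | no _    | no u≢u  | _     | _      = contradiction refl u≢u
      ... | no _    | yes _   | yes _ | _      = from-yes (1 ℕ.<? 4)
      ... | no _    | yes _   | no _  | yes u≼b = contradiction u≼b u⋠b
      ... | no _    | yes _   | no _  | no _   = from-yes (3 ℕ.<? 4)

    pairExtension-lowers-v : ∀ {a} → a ∈ A → v ∈ B → ¬ a ≼ v → AboveIn poset pairExtension a v
    pairExtension-lowers-v {a} a∈A v∈B a⋠v =
      aboveIn-linearExtensionByRank poset rank rank-mono {a} {v}
        (subst₂ ℕ._<_ (sym (rank-∈B v∈B)) (sym (rank-∈A a∈A)) rankB<rankA)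
      where
      rankB<rankA : rankB v ℕ.< rankA a
      rankB<rankA with a ≤? v | a ≟ u | v ≟ v
      ... | yes a≼v | _     | _      = contradiction a≼v a⋠v
      ... | no _    | _     | no v≢v = contradiction refl v≢v
      ... | no _    | yes _ | yes _  = from-yes (1 ℕ.<? 4)
      ... | no _    | no _  | yes _  = from-yes (1 ℕ.<? 2)

  NonNegativeWeights : List (LinearExtension poset × ℚ) → Set
  NonNegativeWeights = All (λ (_ , α) → 0ℚ ℚ.≤ α)

  unitWeights : List (LinearExtension poset) → List (LinearExtension poset × ℚ)
  unitWeights = map (_, 1ℚ)

  unitWeights-nonNegative : ∀ Ls → NonNegativeWeights (unitWeights Ls)
  unitWeights-nonNegative Ls = Allₚ.map⁺ (All.universal (λ _ → ℚₚ.nonNegative⁻¹ 1ℚ) Ls)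

  weightAbove-nonNegative : ∀ {a b ws} → NonNegativeWeights ws → 0ℚ ℚ.≤ weightAbove P a b ws
  weightAbove-nonNegative {ws = []} [] = ℚₚ.≤-refl
  weightAbove-nonNegative {a} {b} {(L , α) ∷ ws} (0≤α ∷ nonNeg)
    with LinearExtension.pos L ⟨$⟩ʳ b Fin.<? LinearExtension.pos L ⟨$⟩ʳ a
  ... | yes _ = ℚₚ.+-mono-≤ 0≤α (weightAbove-nonNegative nonNeg)
  ... | no _  = weightAbove-nonNegative nonNeg

  weight≤weightAbove : ∀ {a b L α ws} → NonNegativeWeights ws → (L , α) ∈ˡ ws →
                       AboveIn poset L a b → α ℚ.≤ weightAbove P a b ws
  weight≤weightAbove {a} {b} {ws = (L′ , α′) ∷ ws} (0≤α′ ∷ nonNeg) L∈ a>b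
    with LinearExtension.pos L′ ⟨$⟩ʳ b Fin.<? LinearExtension.pos L′ ⟨$⟩ʳ a | L∈
  ... | yes _  | here refl = ℚₚ.≤-trans (ℚₚ.≤-reflexive (sym (ℚₚ.+-identityʳ α′)))
                               (ℚₚ.+-monoʳ-≤ α′ (weightAbove-nonNegative nonNeg))
  ... | yes _  | there L∈ws = ℚₚ.≤-trans (weight≤weightAbove nonNeg L∈ws a>b)
                               (ℚₚ.≤-trans (ℚₚ.≤-reflexive (sym (ℚₚ.+-identityˡ _)))
                                 (ℚₚ.+-monoˡ-≤ _ 0≤α′))
  ... | no a≯b | here refl = contradiction a>b a≯b
  ... | no _   | there L∈ws = weight≤weightAbove nonNeg L∈ws a>b

  totalWeight-unitWeights : ∀ Ls → totalWeight P (unitWeights Ls) ≡ + length Ls / 1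
  totalWeight-unitWeights []       = refl
  totalWeight-unitWeights (L ∷ Ls) = begin
    1ℚ ℚ.+ totalWeight P (unitWeights Ls) ≡⟨ cong (1ℚ ℚ.+_) (totalWeight-unitWeights Ls) ⟩
    1ℚ ℚ.+ + k / 1                       ≡⟨ cong (1ℚ ℚ.+_) (ℚₚ.normalize-coprime k/1-coprime) ⟩
    1ℚ ℚ.+ mkℚ (+ k) 0 k/1-coprime       ≡⟨ ℚₚ./-cong (cong (ℤ._+_ (+ 1)) (ℤₚ.*-identityʳ (+ k))) refl ⟩
    + suc k / 1                          ∎
    where
    k = length Ls
    k/1-coprime = coprime-sym (1-coprimeTo k)
    open ≡-Reasoning

lemma4p3 : ∀ {n m : ℕ} (P : BipartitePoset n) (M : Matching P m) →
           IsMaximalMatching M → IdimStar≤ P ((+ m) / 1)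
lemma4p3 {m = m} P M maximal =
  unitWeights P Ls , (unitWeights-nonNegative P Ls , reversed) ,
  ℚₚ.≤-reflexive (trans (totalWeight-unitWeights P Ls) (cong (λ k → + k / 1) (length-tabulate L)))
  where
  open BipartitePoset P
  open IsDecPartialOrder isDecPO using (_≟_)
  open Matching M
  module Ext (i : Fin m) = PairExtension P (u i) (v i) (proj₁ (u∥v i))

  L : Fin m → LinearExtension poset
  L = Ext.pairExtension

  Ls : List (LinearExtension poset)
  Ls = tabulate L

  reversedIn-L : ∀ {a b} i → AboveIn poset (L i) a b → 1ℚ ℚ.≤ weightAbove P a b (unitWeights P Ls)
  reversedIn-L i = weight≤weightAbove P (unitWeights-nonNegative P Ls) (∈-map⁺ (_, 1ℚ) (∈-tabulate⁺ i))

  reversed : ∀ a b → a ∈ A → b ∈ B → Incomparable poset a b →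
             1ℚ ℚ.≤ weightAbove P a b (unitWeights P Ls)
  reversed a b a∈A b∈B a∥b@(a⋠b , _) with any? (λ i → u i ≟ a) | any? (λ i → v i ≟ b)
  ... | yes (i , refl) | _              = reversedIn-L i (Ext.pairExtension-raises-u i a∈A b∈B a⋠b)
  ... | no _           | yes (i , refl) = reversedIn-L i (Ext.pairExtension-lowers-v i a∈A b∈B a⋠b)
  ... | no a∉Q         | no b∉Q         = contradiction a∥b
          (maximal a b a∈A b∈B (λ i eq → a∉Q (i , eq)) (λ i eq → b∉Q (i , eq)))
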